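{- $\mathsf{IKt}2(\Diamond,\Diamond^{\bullet})$ (and hence all its extensions) proves: (1) $\Diamond A \leftrightarrow \forall X(\Box(A\to\blacksquare X)\to X)$; (2) $\Diamond^{\bullet} A\leftrightarrow\forall X(\blacksquare(A\to\Box X)\to X)$, where $X$ is not free in $A$.
   Context: Here $\Diamond$ and the backward diamond $\Diamond^{\bullet}$ are primitive unary operators added to the language $A ::= P \mid X \mid A\to B\mid \Box A\mid\blacksquare A\mid\forall XA$. $\mathsf{IKt}2(\Diamond,\Diamond^{\bullet})$ is axiomatised by: second-order intuitionistic propositional logic (axioms $A\to B\to A$; $(A\to B\to C)\to(A\to B)\to A\to C$; $\forall X(A\to B)\to\forall XA\to\forall XB$; $A\to\forall XA$ for $X\notin\mathrm{fv}(A)$; full comprehension $\forall XA\to A[C/X]$ for any formula $C$; modus ponens; generalisation: from $A[P/X]$ infer $\forall XA$ for $P$ a fresh propositional symbol); normality: $\Box(A\to B)\to\Box A\to\Box B$, $\Box(A\to B)\to\Diamond A\to\Diamond B$, $\blacksquare(A\to B)\to\blacksquare A\to\blacksquare B$, $\blacksquare(A\to B)\to\Diamond^{\bullet}A\to\Diamond^{\bullet}B$, and necessitation rules for $\Box$ and $\blacksquare$; adjunction axioms $\Diamond^{\bullet}\Box A\to A$, $A\to\Box\Diamond^{\bullet}A$, $\Diamond\blacksquare A\to A$, $A\to\blacksquare\Diamond A$. $A\leftrightarrow B$ abbreviates the (second-order encoded) conjunction of $A\to B$ and $B\to A$. -}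

module Defs where

open import Data.Nat using (ℕ; zero; suc)
open import Data.Product using (_×_)
open import Data.Unit using (⊤)
open import Relation.Binary.PropositionalEquality using (_≡_)
open import Relation.Nullary using (¬_)

-- Propositional symbols P are `prop p` (p : ℕ, infinitely many).
-- Second-order variables X are de Bruijn indices `var n`; `all A` binds index 0.
infixr 5 _⇒_
data Fm : Set where
  prop : ℕ → Fm
  var  : ℕ → Fm
  _⇒_  : Fm → Fm → Fm
  □    : Fm → Fm
  ■    : Fm → Fm
  ◇    : Fm → Fm
  ◆    : Fm → Fm
  all  : Fm → Fm

ext : (ℕ → ℕ) → ℕ → ℕ
ext ρ zero    = zero
ext ρ (suc n) = suc (ρ n)

ren : (ℕ → ℕ) → Fm → Fm
ren ρ (prop p) = prop p
ren ρ (var n)  = var (ρ n)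
ren ρ (A ⇒ B)  = ren ρ A ⇒ ren ρ B
ren ρ (□ A)    = □ (ren ρ A)
ren ρ (■ A)    = ■ (ren ρ A)
ren ρ (◇ A)    = ◇ (ren ρ A)
ren ρ (◆ A)    = ◆ (ren ρ A)
ren ρ (all A)  = all (ren (ext ρ) A)

-- weakening: used for "X not free in A" (A is moved under a fresh binder)
wk : Fm → Fm
wk = ren suc

exts : (ℕ → Fm) → ℕ → Fm
exts σ zero    = var zero
exts σ (suc n) = wk (σ n)

sub : (ℕ → Fm) → Fm → Fm
sub σ (prop p) = prop p
sub σ (var n)  = σ n
sub σ (A ⇒ B)  = sub σ A ⇒ sub σ B
sub σ (□ A)    = □ (sub σ A)
sub σ (■ A)    = ■ (sub σ A)
sub σ (◇ A)    = ◇ (sub σ A)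
sub σ (◆ A)    = ◆ (sub σ A)
sub σ (all A)  = all (sub (exts σ) A)

single : Fm → ℕ → Fm
single C zero    = C
single C (suc n) = var n

inst : Fm → Fm → Fm
inst A C = sub (single C) A

_#_ : ℕ → Fm → Set
p # prop q = ¬ (p ≡ q)
p # var n  = ⊤
p # (A ⇒ B) = (p # A) × (p # B)
p # □ A    = p # A
p # ■ A    = p # A
p # ◇ A    = p # A
p # ◆ A    = p # A
p # all A  = p # A

_∧_ : Fm → Fm → Fm
A ∧ B = all ((wk A ⇒ wk B ⇒ var zero) ⇒ var zero)

_⇔_ : Fm → Fm → Fm
A ⇔ B = (A ⇒ B) ∧ (B ⇒ A)

infix 3 ⊢_
data ⊢_ : Fm → Set where
  ax-K  : ∀ {A B} → ⊢ A ⇒ B ⇒ A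
  ax-S  : ∀ {A B C} → ⊢ (A ⇒ B ⇒ C) ⇒ (A ⇒ B) ⇒ A ⇒ C
  ax-∀K : ∀ {A B} → ⊢ all (A ⇒ B) ⇒ all A ⇒ all B
  ax-vac : ∀ {A} → ⊢ A ⇒ all (wk A)
  ax-comp : ∀ {A C} → ⊢ all A ⇒ inst A C                 -- full comprehension
  mp    : ∀ {A B} → ⊢ A ⇒ B → ⊢ A → ⊢ B
  gen   : ∀ {A} p → p # A → ⊢ inst A (prop p) → ⊢ all A
  ax-□K : ∀ {A B} → ⊢ □ (A ⇒ B) ⇒ □ A ⇒ □ B
  ax-◇K : ∀ {A B} → ⊢ □ (A ⇒ B) ⇒ ◇ A ⇒ ◇ B
  ax-■K : ∀ {A B} → ⊢ ■ (A ⇒ B) ⇒ ■ A ⇒ ■ B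
  ax-◆K : ∀ {A B} → ⊢ ■ (A ⇒ B) ⇒ ◆ A ⇒ ◆ B
  nec-□ : ∀ {A} → ⊢ A → ⊢ □ A
  nec-■ : ∀ {A} → ⊢ A → ⊢ ■ A
  ax-◆□ : ∀ {A} → ⊢ ◆ (□ A) ⇒ A
  ax-□◆ : ∀ {A} → ⊢ A ⇒ □ (◆ A)
  ax-◇■ : ∀ {A} → ⊢ ◇ (■ A) ⇒ A
  ax-■◇ : ∀ {A} → ⊢ A ⇒ ■ (◇ A)

-- The forward implications are the adjunctions at work: ◇ A together with
-- □ (A → ■ P) gives ◇ ■ P, hence P; as P is fresh, generalise to ∀X.
-- Backwards, instantiate X := ◇ A, whose premise □ (A → ■ ◇ A) is the
-- necessitated unit of the adjunction.  The past case is the mirror image.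
module Submission where

open import Defs
open import Data.Nat using (ℕ; zero; suc; _⊔_; _<_; s≤s)
open import Data.Nat.Properties using (m≤m⊔n; m≤n⊔m; ≤-trans; ≤-refl; <-irrefl)
open import Data.Product using (_×_; _,_)
open import Data.Unit using (tt)
open import Relation.Binary.PropositionalEquality using (_≡_; refl; cong; cong₂; trans)

⇒-const : ∀ {A B} → ⊢ B → ⊢ A ⇒ B
⇒-const = mp ax-K

⇒-app : ∀ {D A B} → ⊢ D ⇒ A ⇒ B → ⊢ D ⇒ A → ⊢ D ⇒ B
⇒-app f g = mp (mp ax-S f) g

⇒-refl : ∀ {A} → ⊢ A ⇒ A
⇒-refl {A} = mp (mp ax-S ax-K) (ax-K {A} {A})

⇒-trans : ∀ {A B C} → ⊢ A ⇒ B → ⊢ B ⇒ C → ⊢ A ⇒ C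
⇒-trans f g = ⇒-app (⇒-const g) f

⇒-flip : ∀ {A B C} → ⊢ A ⇒ B ⇒ C → ⊢ B ⇒ A ⇒ C
⇒-flip f = ⇒-app (⇒-app (⇒-const ax-S) (⇒-const f)) ax-K

⇒-post : ∀ {D A B C} → ⊢ D ⇒ A ⇒ B → ⊢ B ⇒ C → ⊢ D ⇒ A ⇒ C
⇒-post f g = ⇒-app (⇒-app (⇒-const ax-S) (⇒-const (⇒-const g))) f

⇒-eval : ∀ {A B} → ⊢ A → ⊢ (A ⇒ B) ⇒ B
⇒-eval a = ⇒-app ⇒-refl (⇒-const a)

sub-id : ∀ σ → (∀ n → σ n ≡ var n) → ∀ A → sub σ A ≡ A
sub-id σ σ≗var (prop p) = refl
sub-id σ σ≗var (var n)  = σ≗var n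
sub-id σ σ≗var (A ⇒ B)  = cong₂ _⇒_ (sub-id σ σ≗var A) (sub-id σ σ≗var B)
sub-id σ σ≗var (□ A)    = cong □ (sub-id σ σ≗var A)
sub-id σ σ≗var (■ A)    = cong ■ (sub-id σ σ≗var A)
sub-id σ σ≗var (◇ A)    = cong ◇ (sub-id σ σ≗var A)
sub-id σ σ≗var (◆ A)    = cong ◆ (sub-id σ σ≗var A)
sub-id σ σ≗var (all A)  = cong all (sub-id (exts σ) exts≗var A)
  where
  exts≗var : ∀ n → exts σ n ≡ var n
  exts≗var zero    = refl
  exts≗var (suc n) = cong wk (σ≗var n)

sub-ren : ∀ σ ρ τ → (∀ n → σ (ρ n) ≡ τ n) → ∀ A → sub σ (ren ρ A) ≡ sub τ A
sub-ren σ ρ τ σρ≗τ (prop p) = refl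
sub-ren σ ρ τ σρ≗τ (var n)  = σρ≗τ n
sub-ren σ ρ τ σρ≗τ (A ⇒ B)  = cong₂ _⇒_ (sub-ren σ ρ τ σρ≗τ A) (sub-ren σ ρ τ σρ≗τ B)
sub-ren σ ρ τ σρ≗τ (□ A)    = cong □ (sub-ren σ ρ τ σρ≗τ A)
sub-ren σ ρ τ σρ≗τ (■ A)    = cong ■ (sub-ren σ ρ τ σρ≗τ A)
sub-ren σ ρ τ σρ≗τ (◇ A)    = cong ◇ (sub-ren σ ρ τ σρ≗τ A)
sub-ren σ ρ τ σρ≗τ (◆ A)    = cong ◆ (sub-ren σ ρ τ σρ≗τ A)
sub-ren σ ρ τ σρ≗τ (all A)  = cong all (sub-ren (exts σ) (ext ρ) (exts τ) exts-ext≗exts A)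
  where
  exts-ext≗exts : ∀ n → exts σ (ext ρ n) ≡ exts τ n
  exts-ext≗exts zero    = refl
  exts-ext≗exts (suc n) = cong wk (σρ≗τ n)

inst-wk : ∀ A C → inst (wk A) C ≡ A
inst-wk A C = trans (sub-ren (single C) suc var (λ _ → refl) A) (sub-id var (λ _ → refl) A)

maxProp : Fm → ℕ
maxProp (prop p) = p
maxProp (var n)  = 0
maxProp (A ⇒ B)  = maxProp A ⊔ maxProp B
maxProp (□ A)    = maxProp A
maxProp (■ A)    = maxProp A
maxProp (◇ A)    = maxProp A
maxProp (◆ A)    = maxProp A
maxProp (all A)  = maxProp A

>maxProp⇒# : ∀ A {p} → maxProp A < p → p # A
>maxProp⇒# (prop q) lt refl = <-irrefl refl lt
>maxProp⇒# (var n)  lt = tt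
>maxProp⇒# (A ⇒ B)  lt = >maxProp⇒# A (≤-trans (s≤s (m≤m⊔n _ _)) lt)
                        , >maxProp⇒# B (≤-trans (s≤s (m≤n⊔m _ _)) lt)
>maxProp⇒# (□ A)    lt = >maxProp⇒# A lt
>maxProp⇒# (■ A)    lt = >maxProp⇒# A lt
>maxProp⇒# (◇ A)    lt = >maxProp⇒# A lt
>maxProp⇒# (◆ A)    lt = >maxProp⇒# A lt
>maxProp⇒# (all A)  lt = >maxProp⇒# A lt

∀-intro : ∀ {B} → (∀ p → ⊢ inst B (prop p)) → ⊢ all B
∀-intro {B} ⊢B[p] = gen p (>maxProp⇒# B ≤-refl) (⊢B[p] p)
  where p = suc (maxProp B)

⇒∀-intro : ∀ {F B} → (∀ p → ⊢ F ⇒ inst B (prop p)) → ⊢ F ⇒ all B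
⇒∀-intro {F} {B} ⊢F⇒B[p] = ⇒-trans ax-vac (mp ax-∀K (∀-intro ⊢wkF⇒B[p]))
  where
  ⊢wkF⇒B[p] : ∀ p → ⊢ inst (wk F ⇒ B) (prop p)
  ⊢wkF⇒B[p] p rewrite inst-wk F (prop p) = ⊢F⇒B[p] p

∧-intro : ∀ {A B} → ⊢ A → ⊢ B → ⊢ A ∧ B
∧-intro {A} {B} ⊢A ⊢B = ∀-intro ⊢[A⇒B⇒p]⇒p
  where
  ⊢[A⇒B⇒p]⇒p : ∀ p → ⊢ inst ((wk A ⇒ wk B ⇒ var zero) ⇒ var zero) (prop p)
  ⊢[A⇒B⇒p]⇒p p rewrite inst-wk A (prop p) | inst-wk B (prop p) =
    ⇒-app (⇒-eval ⊢A) (⇒-const ⊢B)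

⇔-∀-intro : ∀ {D B} → (∀ C → ⊢ D ⇒ inst B C) → ⊢ inst B D ⇒ D → ⊢ D ⇔ all B
⇔-∀-intro ⊢D⇒B[C] ⊢B[D]⇒D =
  ∧-intro (⇒∀-intro (λ p → ⊢D⇒B[C] (prop p))) (⇒-trans ax-comp ⊢B[D]⇒D)

◇-elim : ∀ {A C} → ⊢ ◇ A ⇒ □ (A ⇒ ■ C) ⇒ C
◇-elim = ⇒-flip (⇒-post ax-◇K ax-◇■)

◆-elim : ∀ {A C} → ⊢ ◆ A ⇒ ■ (A ⇒ □ C) ⇒ C
◆-elim = ⇒-flip (⇒-post ax-◆K ax-◆□)

◇-encoding : ∀ A → ⊢ ◇ A ⇔ all (□ (wk A ⇒ ■ (var zero)) ⇒ var zero)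
◇-encoding A = ⇔-∀-intro ⊢◇A⇒B[C] ⊢B[◇A]⇒◇A
  where
  ⊢◇A⇒B[C] : ∀ C → ⊢ ◇ A ⇒ □ (inst (wk A) C ⇒ ■ C) ⇒ C
  ⊢◇A⇒B[C] C rewrite inst-wk A C = ◇-elim
  ⊢B[◇A]⇒◇A : ⊢ (□ (inst (wk A) (◇ A) ⇒ ■ (◇ A)) ⇒ ◇ A) ⇒ ◇ A
  ⊢B[◇A]⇒◇A rewrite inst-wk A (◇ A) = ⇒-eval (nec-□ ax-■◇)

◆-encoding : ∀ A → ⊢ ◆ A ⇔ all (■ (wk A ⇒ □ (var zero)) ⇒ var zero)
◆-encoding A = ⇔-∀-intro ⊢◆A⇒B[C] ⊢B[◆A]⇒◆A
  where
  ⊢◆A⇒B[C] : ∀ C → ⊢ ◆ A ⇒ ■ (inst (wk A) C ⇒ □ C) ⇒ C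
  ⊢◆A⇒B[C] C rewrite inst-wk A C = ◆-elim
  ⊢B[◆A]⇒◆A : ⊢ (■ (inst (wk A) (◆ A) ⇒ □ (◆ A)) ⇒ ◆ A) ⇒ ◆ A
  ⊢B[◆A]⇒◆A rewrite inst-wk A (◆ A) = ⇒-eval (nec-■ ax-□◆)

theorem2p7 : ∀ (A : Fm) →
    (⊢ ◇ A ⇔ all (□ (wk A ⇒ ■ (var zero)) ⇒ var zero))
    × (⊢ ◆ A ⇔ all (■ (wk A ⇒ □ (var zero)) ⇒ var zero))
theorem2p7 A = ◇-encoding A , ◆-encoding A
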